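{- Let $m\ge 2$ and let $\mathfrak{m}$ be a rooted and pointed $m$-hypermap on $\mathcal{S}_g$, with each edge oriented so that it has a black face on its right and each vertex labelled by its distance from the pointed vertex (the minimum number of oriented edges of an oriented path from the pointed vertex to it). Then $\mathfrak{m}$ is an $m$-constellation if and only if one of the following two equivalent properties holds: (a) all its edges have increment $-1$ or $m-1$; (b) all the black unlabelled vertices of its mobile $\mathrm{Mob}(\mathfrak{m})$ have degree $1$.
   Context: Maps on the closed orientable surface $\mathcal{S}_g$ are embeddings of finite connected graphs with simply connected faces, up to orientation-preserving homeomorphism. An $m$-hypermap is a map with faces coloured black and white, adjacent faces having different colours, every black face of degree $m$ and every white face of degree a multiple of $m$. It is an $m$-constellation if its vertices can be labelled in $\{1,\dots,m\}$ so that around each black face, clockwise, the labels read $1,\dots,m$. The increment of an oriented edge is the label of its endpoint minus the label of its origin. In the mobile $\mathrm{Mob}(\mathfrak{m})$ (Bouttier–Di Francesco–Guitter construction), each black face $f$ of $\mathfrak{m}$ gives a black unlabelled vertex placed inside $f$, and this vertex is joined by exactly one edge for each edge $e$ of the boundary of $f$ whose increment is $\le 0$ (namely an edge crossing $e$ to the central vertex of the white face on the other side of $e$), and by no other edges; so its degree is the number of edges of $f$ with non-positive increment. -}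

module Defs where

open import Data.Nat using (ℕ; zero; suc; _+_; _≤_; _<_)
open import Data.Nat.Divisibility using (_∣_)
open import Data.Integer as ℤ using (ℤ; +_; _-_)
import Data.Integer.Properties as ℤP
open import Data.Fin using (Fin)
open import Data.Fin.Permutation using (Permutation′; _⟨$⟩ʳ_; _⟨$⟩ˡ_)
open import Data.List using (length; filter; upTo)
open import Data.Product using (Σ; ∃; _×_)
open import Data.Sum using (_⊎_)
open import Relation.Nullary using (¬_)
open import Relation.Binary.PropositionalEquality using (_≡_)
open import Function.Bundles using (_⇔_)

iter : {A : Set} → (A → A) → ℕ → A → A
iter f zero    x = x
iter f (suc k) x = f (iter f k x)

OrbitSize : {A : Set} → (A → A) → A → ℕ → Set
OrbitSize f x k = (0 < k) × (iter f k x ≡ x) × (∀ j → 0 < j → j < k → ¬ (iter f j x ≡ x))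

data Conn {n : ℕ} (β ω : Permutation′ n) (e : Fin n) : Fin n → Set where
  here : Conn β ω e e
  viaβ : ∀ {f} → Conn β ω e f → Conn β ω e (β ⟨$⟩ʳ f)
  viaω : ∀ {f} → Conn β ω e f → Conn β ω e (ω ⟨$⟩ʳ f)

-- Combinatorial encoding of an m-hypermap (a face-bicoloured map) on a closed
-- orientable surface.  The darts are the edges of the map (Fin nD), each edge
-- oriented so that it has its black face on its right.
--   β e : the next edge after e along the boundary of its black face (clockwise),
--   ω e : the next edge after e along the boundary of its white face,
--   org e : the origin vertex of e.
-- The end of e is the origin of β e (equivalently of ω e).  The outgoing edges
-- around a vertex are the orbits of σ = ω ∘ β⁻¹, and vertices are exactly these
-- orbits.  The genus g is determined by the data (Euler's formula) and is arbitrary.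
record Hypermap (m : ℕ) : Set where
  field
    nD nV : ℕ
    β ω   : Permutation′ nD
    org   : Fin nD → Fin nV
    root  : Fin nD
  σ : Fin nD → Fin nD
  σ e = ω ⟨$⟩ʳ (β ⟨$⟩ˡ e)
  tgt : Fin nD → Fin nV
  tgt e = org (β ⟨$⟩ʳ e)
  field
    vertices    : ∀ e f → (org e ≡ org f) ⇔ (∃ λ k → iter σ k e ≡ f)
    org-surj    : ∀ v → ∃ λ e → org e ≡ v
    connected   : ∀ e f → Conn β ω e f
    black-deg   : ∀ e → OrbitSize (β ⟨$⟩ʳ_) e m
    white-deg   : ∀ e k → OrbitSize (ω ⟨$⟩ʳ_) e k → m ∣ k

module _ {m : ℕ} (H : Hypermap m) where
  open Hypermap H

  data Walk : Fin nV → Fin nV → ℕ → Set where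
    [] : ∀ {u} → Walk u u 0
    _∷_ : ∀ {w k} (e : Fin nD) → Walk (tgt e) w k → Walk (org e) w (suc k)

  IsDistanceLabelling : Fin nV → (Fin nV → ℕ) → Set
  IsDistanceLabelling p d = ∀ w → Walk p w (d w) × (∀ k → Walk p w k → d w ≤ k)

  increment : (Fin nV → ℕ) → Fin nD → ℤ
  increment d e = (+ d (tgt e)) - (+ d (org e))

  IsConstellation : Set
  IsConstellation = Σ (Fin nV → ℕ) λ c →
      (∀ v → 1 ≤ c v × c v ≤ m)
    × (∀ e → ∃ λ j → ∀ k → k < m → c (org (iter (β ⟨$⟩ʳ_) (j + k) e)) ≡ suc k)

  -- degree in Mob(𝔪) of the black vertex of the black face containing edge e:
  -- number of edges on that face with non-positive increment
  mobBlackDegree : (Fin nV → ℕ) → Fin nD → ℕ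
  mobBlackDegree d e =
    length (filter (λ k → increment d (iter (β ⟨$⟩ʳ_) k e) ℤP.≤? + 0) (upTo m))

-- Along an
-- edge d grows by at most 1, and going back around the black face gives
-- d (org e) ≤ d (tgt e) + (m − 1), so every increment lies in [−(m−1), 1].
--
-- If 𝔪 is an m-constellation with labelling c, then c grows by 1 mod m along
-- every edge, hence c ≡ c p + d (mod m) along geodesics, so every increment is
-- ≡ 1 (mod m); in the window [−(m−1), 1] this leaves 1 and −(m−1). Conversely
-- if all increments are 1 or −(m−1), then 1 + (d mod m) is a constellation
-- labelling.
--
-- Around a black face the increments sum to 0. With increments 1 and −(m−1)
-- only, this forces exactly one non-positive increment per face. Conversely, if
-- a face has a single non-positive edge e, the other m − 1 edges rise by
-- exactly 1, which forces the increment of e to be −(m−1).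
module Submission where

open import Defs
open import Data.Nat
  using (ℕ; zero; suc; _+_; _*_; _∸_; _≤_; _<_; _≤?_; s≤s; z≤n; NonZero; >-nonZero⁻¹)
open import Data.Nat.Properties
open import Data.Nat.DivMod
  using (_%_; _/_; m≡m%n+[m/n]*n; %-distribˡ-+; m%n%n≡m%n; m%n<n; m<n⇒m%n≡m; [m+kn]%n≡m%n; %-remove-+ˡ)
open import Data.Nat.Divisibility using (_∣_; divides; ∣-refl; n∣m*n; ∣m+n∣m⇒∣n)
open import Data.Nat.Tactic.RingSolver using (solve-∀)
open import Data.Integer as ℤ using (+_; -_; _⊖_)
import Data.Integer.Properties as ℤ
open import Data.Fin using (Fin)
open import Data.Fin.Permutation using (_⟨$⟩ʳ_)
open import Data.List using ([]; _∷_; [_]; _++_; length; filter; upTo; applyUpTo)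
open import Data.List.Properties
  using (upTo-∷ʳ; filter-++; length-++; filter-accept; filter-reject; filter-some)
open import Data.List.Membership.Propositional using (lose)
open import Data.List.Membership.Propositional.Properties using (∈-applyUpTo⁺)
open import Data.Product using (∃; _×_; _,_; proj₁; proj₂)
open import Data.Sum as Sum using (_⊎_; inj₁; inj₂)
open import Data.Sum.Function.Propositional using (_⊎-⇔_)
open import Data.Empty using (⊥-elim)
open import Relation.Nullary using (¬_; yes; no)
open import Relation.Unary using (Decidable)
open import Relation.Binary.PropositionalEquality
  using (_≡_; refl; sym; trans; cong; cong₂; subst; module ≡-Reasoning)
open import Function.Bundles using (_⇔_; mk⇔; Equivalence)
open import Function.Base using (_∘_)
import Function.Properties.Equivalence as ⇔

Π-⇔ : {A : Set} {P Q : A → Set} → (∀ x → P x ⇔ Q x) → (∀ x → P x) ⇔ (∀ x → Q x)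
Π-⇔ P⇔Q = mk⇔ (λ p x → Equivalence.to (P⇔Q x) (p x)) (λ q x → Equivalence.from (P⇔Q x) (q x))

a⊖b≡+k⇔a≡k+b : ∀ a b k → a ⊖ b ≡ + k ⇔ a ≡ k + b
a⊖b≡+k⇔a≡k+b a b k = mk⇔ to from
  where
  to : a ⊖ b ≡ + k → a ≡ k + b
  to eq with b ≤? a
  ... | yes b≤a =
    trans (sym (m∸n+n≡m b≤a)) (cong (_+ b) (ℤ.+-injective (trans (sym (ℤ.⊖-≥ b≤a)) eq)))
  ... | no b≰a with () ← trans (sym (ℤ.sign-⊖-≰ b≰a)) (cong ℤ.sign eq)
  from : a ≡ k + b → a ⊖ b ≡ + k
  from refl = trans (ℤ.⊖-≥ (m≤n+m b k)) (cong +_ (m+n∸n≡m k b))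

[+b]-[+a]≡+k⇔b≡k+a : ∀ a b k → + b ℤ.- + a ≡ + k ⇔ b ≡ k + a
[+b]-[+a]≡+k⇔b≡k+a a b k rewrite ℤ.[+m]-[+n]≡m⊖n b a = a⊖b≡+k⇔a≡k+b b a k

[+b]-[+a]≡-k⇔a≡k+b : ∀ a b k → + b ℤ.- + a ≡ - + k ⇔ a ≡ k + b
[+b]-[+a]≡-k⇔a≡k+b a b k rewrite ℤ.[+m]-[+n]≡m⊖n b a | ℤ.⊖-swap b a =
  ⇔.trans (mk⇔ ℤ.neg-injective (cong -_)) (a⊖b≡+k⇔a≡k+b a b k)

[+b]-[+a]≤0⇔b≤a : ∀ a b → + b ℤ.- + a ℤ.≤ + 0 ⇔ b ≤ a
[+b]-[+a]≤0⇔b≤a a b =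
  mk⇔ (λ le → ℤ.drop‿+≤+ (ℤ.i-j≤0⇒i≤j le)) (λ le → ℤ.i≤j⇒i-j≤0 (ℤ.+≤+ le))

[k+a%m]%m≡[k+a]%m : ∀ k a m .{{_ : NonZero m}} → (k + a % m) % m ≡ (k + a) % m
[k+a%m]%m≡[k+a]%m k a m = begin
  (k + a % m) % m              ≡⟨ %-distribˡ-+ k (a % m) m ⟩
  (k % m + a % m % m) % m      ≡⟨ cong (λ x → (k % m + x) % m) (m%n%n≡m%n a m) ⟩
  (k % m + a % m) % m          ≡⟨ %-distribˡ-+ k a m ⟨
  (k + a) % m                  ∎
  where open ≡-Reasoning

%-+-congˡ : ∀ k {a b} m .{{_ : NonZero m}} → a % m ≡ b % m → (k + a) % m ≡ (k + b) % m
%-+-congˡ k {a} {b} m eq = begin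
  (k + a) % m        ≡⟨ [k+a%m]%m≡[k+a]%m k a m ⟨
  (k + a % m) % m    ≡⟨ cong (λ x → (k + x) % m) eq ⟩
  (k + b % m) % m    ≡⟨ [k+a%m]%m≡[k+a]%m k b m ⟩
  (k + b) % m        ∎
  where open ≡-Reasoning

[r+y]%m≡y%m⇒m∣r : ∀ r y m .{{_ : NonZero m}} → (r + y) % m ≡ y % m → m ∣ r
[r+y]%m≡y%m⇒m∣r r y m eq =
  ∣m+n∣m⇒∣n (divides ((r + y) / m) (+-cancelˡ-≡ (y % m) _ _ decomposition)) (n∣m*n (y / m))
  where
  decomposition : y % m + ((y / m) * m + r) ≡ y % m + ((r + y) / m) * m
  decomposition = begin
    y % m + ((y / m) * m + r)        ≡⟨ rearrange (y % m) ((y / m) * m) r ⟩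
    r + (y % m + (y / m) * m)        ≡⟨ cong (λ z → r + z) (m≡m%n+[m/n]*n y m) ⟨
    r + y                            ≡⟨ m≡m%n+[m/n]*n (r + y) m ⟩
    (r + y) % m + ((r + y) / m) * m  ≡⟨ cong (_+ ((r + y) / m) * m) eq ⟩
    y % m + ((r + y) / m) * m        ∎
    where
    open ≡-Reasoning
    rearrange : ∀ a b c → a + (b + c) ≡ c + (a + b)
    rearrange = solve-∀

m∣r≤m⇒r≡0∨r≡m : ∀ {m r} .{{_ : NonZero m}} → m ∣ r → r ≤ m → r ≡ 0 ⊎ r ≡ m
m∣r≤m⇒r≡0∨r≡m (divides zero r≡0) _ = inj₁ r≡0
m∣r≤m⇒r≡0∨r≡m {m} (divides (suc zero) r≡m+0) _ = inj₂ (trans r≡m+0 (+-identityʳ m))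
m∣r≤m⇒r≡0∨r≡m {m} (divides (suc (suc q)) refl) r≤m =
  ⊥-elim (<⇒≱ (m<m+n m (<-≤-trans (>-nonZero⁻¹ m) (m≤m+n m (q * m)))) r≤m)

%-window : ∀ {a b} x m .{{_ : NonZero m}} →
           a ≤ b → b ≤ m + a → (a + x) % m ≡ (b + x) % m → b ≡ a ⊎ b ≡ m + a
%-window {a} {b} x m a≤b b≤m+a eq =
  Sum.map (λ r≡0 → trans b≡r+a (cong (_+ a) r≡0)) (λ r≡m → trans b≡r+a (cong (_+ a) r≡m))
          (m∣r≤m⇒r≡0∨r≡m m∣r r≤m)
  where
  r = b ∸ a
  b≡r+a : b ≡ r + a
  b≡r+a = sym (m∸n+n≡m a≤b)
  r≤m : r ≤ m
  r≤m = m≤n+o⇒m∸n≤o b a (subst (b ≤_) (+-comm m a) b≤m+a)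
  m∣r : m ∣ r
  m∣r = [r+y]%m≡y%m⇒m∣r r (a + x) m
          (trans (cong (_% m) (trans (sym (+-assoc r a x)) (cong (_+ x) (sym b≡r+a)))) (sym eq))

module _ {A : Set} (f : A → A) where

  iter-suc : ∀ k x → iter f k (f x) ≡ iter f (suc k) x
  iter-suc zero    x = refl
  iter-suc (suc k) x = cong f (iter-suc k x)

  iter-+ : ∀ i j x → iter f (i + j) x ≡ iter f i (iter f j x)
  iter-+ zero    j x = refl
  iter-+ (suc i) j x = cong f (iter-+ i j x)

  iter-*-periodic : ∀ {k x} → iter f k x ≡ x → ∀ q → iter f (q * k) x ≡ x
  iter-*-periodic         period zero    = refl
  iter-*-periodic {k} {x} period (suc q) =
    trans (iter-+ k (q * k) x) (trans (cong (iter f k) (iter-*-periodic period q)) period)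

  iter-% : ∀ {k x} .{{_ : NonZero k}} → iter f k x ≡ x → ∀ i → iter f i x ≡ iter f (i % k) x
  iter-% {k} {x} period i = begin
    iter f i x                               ≡⟨ cong (λ j → iter f j x) (m≡m%n+[m/n]*n i k) ⟩
    iter f (i % k + (i / k) * k) x           ≡⟨ iter-+ (i % k) ((i / k) * k) x ⟩
    iter f (i % k) (iter f ((i / k) * k) x)  ≡⟨ cong (iter f (i % k)) (iter-*-periodic period (i / k)) ⟩
    iter f (i % k) x                         ∎
    where open ≡-Reasoning

module Count {P : ℕ → Set} (P? : Decidable P) where

  count : ℕ → ℕ
  count N = length (filter P? (upTo N))

  private
    count-suc : ∀ N → count (suc N) ≡ count N + length (filter P? [ N ])
    count-suc N = begin
      length (filter P? (upTo (suc N)))               ≡⟨ cong (λ xs → length (filter P? xs)) (upTo-∷ʳ N) ⟨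
      length (filter P? (upTo N ++ [ N ]))            ≡⟨ cong length (filter-++ P? (upTo N) [ N ]) ⟩
      length (filter P? (upTo N) ++ filter P? [ N ])  ≡⟨ length-++ (filter P? (upTo N)) ⟩
      count N + length (filter P? [ N ])              ∎
      where open ≡-Reasoning

  count-accept : ∀ {N} → P N → count (suc N) ≡ suc (count N)
  count-accept {N} PN =
    trans (count-suc N) (trans (cong (λ xs → count N + length xs) (filter-accept P? PN)) (+-comm (count N) 1))

  count-reject : ∀ {N} → ¬ P N → count (suc N) ≡ count N
  count-reject {N} ¬PN =
    trans (count-suc N) (trans (cong (λ xs → count N + length xs) (filter-reject P? ¬PN)) (+-identityʳ (count N)))

  count≡1⇒unique : ∀ {N k} → P 0 → count (suc N) ≡ 1 → k < N → ¬ P (suc k)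
  count≡1⇒unique {N} {k} P0 count≡1 k<N Psk =
    <-irrefl (sym rest≡0) (filter-some P? (lose (∈-applyUpTo⁺ suc k<N) Psk))
    where
    rest≡0 : length (filter P? (applyUpTo suc N)) ≡ 0
    rest≡0 = suc-injective (trans (cong length (sym (filter-accept P? P0))) count≡1)

module _ {n : ℕ} (H : Hypermap (suc n)) where
  open Hypermap H

  private
    m : ℕ
    m = suc n

  β^ : ℕ → Fin nD → Fin nD
  β^ = iter (β ⟨$⟩ʳ_)

  β^-period : ∀ e → β^ m e ≡ e
  β^-period e = proj₁ (proj₂ (black-deg e))

  _++ʷ_ : ∀ {u v w k l} → Walk H u v k → Walk H v w l → Walk H u w (k + l)
  []         ++ʷ walk′ = walk′
  (e ∷ walk) ++ʷ walk′ = e ∷ (walk ++ʷ walk′)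

  faceWalk : ∀ e k → Walk H (org e) (org (β^ k e)) k
  faceWalk e zero    = []
  faceWalk e (suc k) =
    e ∷ subst (λ f → Walk H (tgt e) (org f) k) (iter-suc _ k e) (faceWalk (β ⟨$⟩ʳ e) k)

  returnWalk : ∀ e → Walk H (tgt e) (org e) n
  returnWalk e =
    subst (λ f → Walk H (tgt e) (org f) n) (trans (iter-suc _ n e) (β^-period e)) (faceWalk (β ⟨$⟩ʳ e) n)

  IsCyclicLabelling : (Fin nV → ℕ) → Set
  IsCyclicLabelling ℓ = ∀ e → ℓ (tgt e) % m ≡ suc (ℓ (org e)) % m

  cyclic-walk : ∀ {ℓ} → IsCyclicLabelling ℓ → ∀ {u w k} → Walk H u w k → ℓ w % m ≡ (k + ℓ u) % m
  cyclic-walk cyclic [] = refl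
  cyclic-walk {ℓ} cyclic {w = w} {k = suc k} (e ∷ walk) = begin
    ℓ w % m                   ≡⟨ cyclic-walk {ℓ} cyclic walk ⟩
    (k + ℓ (tgt e)) % m       ≡⟨ %-+-congˡ k m (cyclic e) ⟩
    (k + suc (ℓ (org e))) % m ≡⟨ cong (_% m) (+-suc k (ℓ (org e))) ⟩
    (suc k + ℓ (org e)) % m   ∎
    where open ≡-Reasoning

  constellation⇒cyclic : ∀ {c} → (∀ e → ∃ λ j → ∀ k → k < m → c (org (β^ (j + k) e)) ≡ suc k) →
                         IsCyclicLabelling c
  constellation⇒cyclic {c} reads e with j , reads-from-j ← reads e = begin
    c (tgt e) % m                ≡⟨ cong (_% m) (label 1) ⟩
    (1 + (1 + n * j) % m) % m    ≡⟨ [k+a%m]%m≡[k+a]%m 1 (1 + n * j) m ⟩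
    (2 + n * j) % m              ≡⟨ [k+a%m]%m≡[k+a]%m 2 (n * j) m ⟨
    (2 + (n * j) % m) % m        ≡⟨ cong (λ l → suc l % m) (label 0) ⟨
    suc (c (org e)) % m          ∎
    where
    open ≡-Reasoning
    label : ∀ i → c (org (β^ i e)) ≡ suc ((i + n * j) % m)
    label i = trans (cong (λ f → c (org f)) same-edge) (reads-from-j t (m%n<n (i + n * j) m))
      where
      t = (i + n * j) % m
      same-residue : i % m ≡ (j + t) % m
      same-residue = begin
        i % m                   ≡⟨ [m+kn]%n≡m%n i j m ⟨
        (i + j * m) % m         ≡⟨ cong (_% m) (reassociate n i j) ⟩
        (j + (i + n * j)) % m   ≡⟨ [k+a%m]%m≡[k+a]%m j (i + n * j) m ⟨
        (j + t) % m             ∎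
        where
        reassociate : ∀ n i j → i + j * suc n ≡ j + (i + n * j)
        reassociate = solve-∀
      same-edge : β^ i e ≡ β^ (j + t) e
      same-edge = begin
        β^ i e             ≡⟨ iter-% _ (β^-period e) i ⟩
        β^ (i % m) e       ≡⟨ cong (λ l → β^ l e) same-residue ⟩
        β^ ((j + t) % m) e ≡⟨ iter-% _ (β^-period e) (j + t) ⟨
        β^ (j + t) e       ∎

  cyclic⇒constellation : ∀ {ℓ} → IsCyclicLabelling ℓ → IsConstellation H
  cyclic⇒constellation {ℓ} cyclic =
    (λ v → suc (ℓ v % m)) , (λ v → s≤s z≤n , m%n<n (ℓ v) m) , reads
    where
    reads : ∀ e → ∃ λ j → ∀ k → k < m → suc (ℓ (org (β^ (j + k) e)) % m) ≡ suc k
    reads e = n * ℓ (org e) , λ k k<m → cong suc (begin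
      ℓ (org (β^ (n * ℓ (org e) + k) e)) % m   ≡⟨ cyclic-walk {ℓ} cyclic (faceWalk e (n * ℓ (org e) + k)) ⟩
      (n * ℓ (org e) + k + ℓ (org e)) % m      ≡⟨ cong (_% m) (full-turns n (ℓ (org e)) k) ⟩
      (k + ℓ (org e) * m) % m                  ≡⟨ [m+kn]%n≡m%n k (ℓ (org e)) m ⟩
      k % m                                    ≡⟨ m<n⇒m%n≡m k<m ⟩
      k                                        ∎)
      where
      open ≡-Reasoning
      full-turns : ∀ n a k → n * a + k + a ≡ k + a * suc n
      full-turns = solve-∀

  HasConstellationIncrement : (Fin nV → ℕ) → Fin nD → Set
  HasConstellationIncrement d e = d (tgt e) ≡ suc (d (org e)) ⊎ d (org e) ≡ n + d (tgt e)

  increments⇒cyclic : ∀ {d} → (∀ e → HasConstellationIncrement d e) → IsCyclicLabelling d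
  increments⇒cyclic {d} increments e with increments e
  ... | inj₁ rises = cong (_% m) rises
  ... | inj₂ drops =
    sym (trans (cong (λ l → suc l % m) drops) (%-remove-+ˡ (d (tgt e)) (∣-refl {m})))

  nonPositive⇔ : ∀ d e → increment H d e ℤ.≤ + 0 ⇔ d (tgt e) ≤ d (org e)
  nonPositive⇔ d e = [+b]-[+a]≤0⇔b≤a (d (org e)) (d (tgt e))

  increment⇔ : ∀ d e →
               HasConstellationIncrement d e ⇔ (increment H d e ≡ + 1 ⊎ increment H d e ≡ - (+ n))
  increment⇔ d e =
        ⇔.sym ([+b]-[+a]≡+k⇔b≡k+a (d (org e)) (d (tgt e)) 1)
    ⊎-⇔ ⇔.sym ([+b]-[+a]≡-k⇔a≡k+b (d (org e)) (d (tgt e)) n)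

  rises⇒positive : ∀ {d e} → d (tgt e) ≡ suc (d (org e)) → ¬ increment H d e ℤ.≤ + 0
  rises⇒positive {d} {e} rises nonPositive =
    n≮n (d (org e)) (subst (_≤ d (org e)) rises (Equivalence.to (nonPositive⇔ d e) nonPositive))

  drops⇒nonPositive : ∀ {d e} → d (org e) ≡ n + d (tgt e) → increment H d e ℤ.≤ + 0
  drops⇒nonPositive {d} {e} drops =
    Equivalence.from (nonPositive⇔ d e) (subst (d (tgt e) ≤_) (sym drops) (m≤n+m (d (tgt e)) n))

  module FaceCount (d : Fin nV → ℕ) (e : Fin nD) =
    Count (λ k → increment H d (β^ k e) ℤ.≤? + 0)

  increments⇒mobDegree : ∀ {d} → (∀ e → HasConstellationIncrement d e) →
                         ∀ e → mobBlackDegree H d e ≡ 1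
  increments⇒mobDegree {d} increments e =
    *-cancelˡ-≡ (count m) 1 m (+-cancelˡ-≡ (x 0) _ _ (begin
      x 0 + m * count m   ≡⟨ cong (λ f → d (org f) + m * count m) (β^-period e) ⟨
      x m + m * count m   ≡⟨ height m ⟩
      x 0 + m             ≡⟨ cong (λ y → x 0 + y) (*-identityʳ m) ⟨
      x 0 + m * 1         ∎))
    where
    open FaceCount d e
    open ≡-Reasoning
    x : ℕ → ℕ
    x k = d (org (β^ k e))
    height : ∀ k → x k + m * count k ≡ x 0 + k
    height zero = cong (λ y → x 0 + y) (*-zeroʳ m)
    height (suc k) with increments (β^ k e)
    ... | inj₁ rises = begin
      x (suc k) + m * count (suc k)  ≡⟨ cong₂ (λ a c → a + m * c) rises
                                              (count-reject (rises⇒positive {d} rises)) ⟩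
      suc (x k + m * count k)        ≡⟨ cong suc (height k) ⟩
      suc (x 0 + k)                  ≡⟨ +-suc (x 0) k ⟨
      x 0 + suc k                    ∎
    ... | inj₂ drops = begin
      x (suc k) + m * count (suc k)      ≡⟨ cong (λ c → x (suc k) + m * c)
                                                 (count-accept (drops⇒nonPositive {d} drops)) ⟩
      x (suc k) + m * suc (count k)      ≡⟨ one-more-turn n (x (suc k)) (count k) ⟩
      suc (n + x (suc k) + m * count k)  ≡⟨ cong (λ a → suc (a + m * count k)) drops ⟨
      suc (x k + m * count k)            ≡⟨ cong suc (height k) ⟩
      suc (x 0 + k)                      ≡⟨ +-suc (x 0) k ⟨
      x 0 + suc k                        ∎
      where
      one-more-turn : ∀ n a c → a + suc n * suc c ≡ suc (n + a + suc n * c)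
      one-more-turn = solve-∀

  module _ {p : Fin nV} {d : Fin nV → ℕ} (isDist : IsDistanceLabelling H p d) where

    geodesic : ∀ v → Walk H p v (d v)
    geodesic v = proj₁ (isDist v)

    walk-≤ : ∀ {u w k} → Walk H u w k → d w ≤ k + d u
    walk-≤ {u} {w} {k} walk =
      subst (d w ≤_) (+-comm (d u) k) (proj₂ (isDist w) (d u + k) (geodesic u ++ʷ walk))

    cyclic⇒increments : ∀ {c} → IsCyclicLabelling c → ∀ e → HasConstellationIncrement d e
    cyclic⇒increments {c} cyclic e =
      Sum.map sym suc-injective
        (%-window (c p) m (walk-≤ (e ∷ [])) (s≤s (walk-≤ (returnWalk e))) congruent)
      where
      along-geodesic : ∀ v → c v % m ≡ (d v + c p) % m
      along-geodesic v = cyclic-walk {c} cyclic (geodesic v)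
      congruent : (d (tgt e) + c p) % m ≡ (suc (d (org e)) + c p) % m
      congruent = begin
        (d (tgt e) + c p) % m        ≡⟨ along-geodesic (tgt e) ⟨
        c (tgt e) % m                ≡⟨ cyclic e ⟩
        suc (c (org e)) % m          ≡⟨ %-+-congˡ 1 m (along-geodesic (org e)) ⟩
        (suc (d (org e)) + c p) % m  ∎
        where open ≡-Reasoning

    constellation⇔increments : IsConstellation H ⇔ (∀ e → HasConstellationIncrement d e)
    constellation⇔increments = mk⇔
      (λ (c , _ , reads) → cyclic⇒increments {c} (constellation⇒cyclic {c} reads))
      (λ increments → cyclic⇒constellation {d} (increments⇒cyclic {d} increments))

    positive⇒rises : ∀ e → ¬ increment H d e ℤ.≤ + 0 → d (tgt e) ≡ suc (d (org e))
    positive⇒rises e positive =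
      ≤-antisym (walk-≤ (e ∷ [])) (≰⇒> (positive ∘ Equivalence.from (nonPositive⇔ d e)))

    mobDegree⇒increments : (∀ e → mobBlackDegree H d e ≡ 1) → ∀ e → HasConstellationIncrement d e
    mobDegree⇒increments degree e with increment H d e ℤ.≤? + 0
    ... | no positive     = inj₁ (positive⇒rises e positive)
    ... | yes nonPositive =
      inj₂ (trans (cong (λ f → d (org f)) (sym (β^-period e))) (ascent n ≤-refl))
      where
      open FaceCount d e
      x : ℕ → ℕ
      x k = d (org (β^ k e))
      ascent : ∀ i → i ≤ n → x (suc i) ≡ i + x 1
      ascent zero    _     = refl
      ascent (suc i) 1+i≤n =
        trans (positive⇒rises (β^ (suc i) e) (count≡1⇒unique nonPositive (degree e) 1+i≤n))
              (cong suc (ascent i (≤-trans (n≤1+n i) 1+i≤n)))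

    increments⇔mobDegree : (∀ e → HasConstellationIncrement d e) ⇔ (∀ e → mobBlackDegree H d e ≡ 1)
    increments⇔mobDegree = mk⇔ (increments⇒mobDegree {d}) mobDegree⇒increments

-- The argument works for every m ≥ 1; the hypothesis 2 ≤ m only excludes m = 0.
lemma3 : (m : ℕ) → 2 ≤ m → (H : Hypermap m) → (p : Fin (Hypermap.nV H)) →
         (d : Fin (Hypermap.nV H) → ℕ) → IsDistanceLabelling H p d →
         (IsConstellation H
            ⇔ (∀ e → (increment H d e ≡ + 1) ⊎ (increment H d e ≡ - (+ (m ∸ 1)))))
         × ((∀ e → (increment H d e ≡ + 1) ⊎ (increment H d e ≡ - (+ (m ∸ 1))))
            ⇔ (∀ e → mobBlackDegree H d e ≡ 1))
lemma3 zero ()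
lemma3 (suc n) _ H p d isDist =
    ⇔.trans (constellation⇔increments H isDist) increments⇔
  , ⇔.trans (⇔.sym increments⇔) (increments⇔mobDegree H isDist)
  where
  increments⇔ : (∀ e → HasConstellationIncrement H d e)
                ⇔ (∀ e → increment H d e ≡ + 1 ⊎ increment H d e ≡ - (+ n))
  increments⇔ = Π-⇔ (increment⇔ H d)
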